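{- For all $n\geq 2$, the number $d_n(321)$ of desarrangements of length $n$ avoiding the pattern $321$ equals the Catalan number $C_{n-1}=\frac{1}{n}\binom{2n-2}{n-1}$.
   Context: Permutations are in one-line notation. An index $i\in[n-1]$ is a descent of $\pi\in\mathfrak{S}_n$ if $\pi_i>\pi_{i+1}$; $i\in[n]$ is an ascent if it is not a descent (so $n$ is always an ascent). A desarrangement is a permutation whose first ascent is even. For a set $\Pi$ of patterns, $d_n(\Pi)$ is the number of desarrangements in $\mathfrak{S}_n$ avoiding every pattern in $\Pi$, where $\pi$ avoids $\sigma$ if no subsequence of $\pi$ has the same relative order as $\sigma$. -}

module Defs where

open import Data.Bool using (Bool; true; false; _∧_; _∨_; not; if_then_else_)
open import Data.Nat using (ℕ; zero; suc; _+_; _∸_; _<ᵇ_; _≡ᵇ_)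
open import Data.Nat.Combinatorics using (_C_)
open import Data.Fin using (Fin; toℕ)
open import Data.List using (List; []; _∷_; length; filterᵇ; concatMap; map; allFin)
open import Data.Bool.ListAction using (any)

-- Permutations of [n] in one-line notation are represented as lists of
-- natural numbers (the values π_1, …, π_n, in order).

words : ℕ → ℕ → List (List ℕ)
words n zero = [] ∷ []
words n (suc m) = concatMap (λ x → map (x ∷_) (words n m)) (map (λ i → suc (toℕ i)) (allFin n))

elemᵇ : ℕ → List ℕ → Bool
elemᵇ x = any (x ≡ᵇ_)

distinct : List ℕ → Bool
distinct [] = true
distinct (x ∷ xs) = not (elemᵇ x xs) ∧ distinct xs

perms : ℕ → List (List ℕ)
perms n = filterᵇ distinct (words n n)

has21below : ℕ → List ℕ → Bool
has21below x [] = false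
has21below x (y ∷ ys) = ((y <ᵇ x) ∧ any (_<ᵇ y) ys) ∨ has21below x ys

contains321 : List ℕ → Bool
contains321 [] = false
contains321 (x ∷ xs) = has21below x xs ∨ contains321 xs

avoids321 : List ℕ → Bool
avoids321 π = not (contains321 π)

-- firstAscent π : the smallest 1-based index i such that i = n or π_i < π_{i+1}
-- (i.e. the first index that is not a descent).
firstAscent : List ℕ → ℕ
firstAscent [] = 0     -- not used: π is nonempty in the theorem (n ≥ 2)
firstAscent (x ∷ []) = 1
firstAscent (x ∷ y ∷ ys) = if y <ᵇ x then suc (firstAscent (y ∷ ys)) else 1

evenᵇ : ℕ → Bool
evenᵇ zero = true
evenᵇ (suc zero) = false
evenᵇ (suc (suc n)) = evenᵇ n

isDesarrangement : List ℕ → Bool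
isDesarrangement π = evenᵇ (firstAscent π)

d321 : ℕ → ℕ
d321 n = length (filterᵇ (λ π → isDesarrangement π ∧ avoids321 π) (perms n))

-- The Catalan number C_{n-1}, written as in the paper: (1/n) * binom(2n-2, n-1)
-- (exact division; n ≥ 1 supplies the NonZero instance via suc).
catalanPrev : (n : ℕ) → ℕ
catalanPrev zero = 0   -- not used (n ≥ 2 in the theorem)
catalanPrev (suc m) = ((m + m) C m) Data.Nat./ suc m
  where import Data.Nat

module Submission where

-- Reading a word from left to right, an entry below the running maximum
-- completes a 321 exactly when it is smaller than an earlier entry below the
-- running maximum.  Hence a 321-avoiding prefix is summarised by its maximum M
-- and its latest non-record entry t, and the number of its completions to a
-- permutation depends only on the number b of free values between t and M and
-- the number c of values above M.  These counts obey the ballot recursion, so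
-- with N = b + 2c they equal N C c − N C (c − 1).  A 321-avoiding
-- desarrangement starts with a descent onto 1; summing over its first entry
-- gives b = 0, c = n − 1, i.e. the Catalan number C_{n−1}.

open import Data.Bool using (Bool; true; false; _∧_; _∨_; not; if_then_else_; T)
open import Data.Bool.ListAction using (any; all)
open import Data.Bool.Properties using (T-≡; ∨-zeroʳ; ∧-zeroʳ)
open import Data.Fin using (Fin; toℕ)
open import Data.List using (List; []; _∷_; _++_; length; filterᵇ; map; concatMap; tabulate; allFin)
open import Data.List.Properties using (filter-++; length-++; map-∘; map-tabulate)
open import Data.Nat
open import Data.Nat.Combinatorics using (_C_; nCk+nC[k+1]≡[n+1]C[k+1]; nC1≡n; nCk≡nC[n∸k])
open import Data.Nat.DivMod using (m*n/n≡m)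
open import Data.Nat.ListAction using (sum)
open import Data.Nat.Properties
open import Data.Nat.Solver using (module +-*-Solver)
open import Function.Bundles using (Equivalence)
open import Relation.Binary.PropositionalEquality
open import Relation.Nullary using (contradiction)

open +-*-Solver using (solve; _:+_; _:*_; _:=_; con)

open import Defs

∑ : ℕ → (ℕ → ℕ) → ℕ
∑ zero    f = 0
∑ (suc k) f = f 0 + ∑ k (λ i → f (suc i))

∑-cong : ∀ k {f g : ℕ → ℕ} → (∀ i → i < k → f i ≡ g i) → ∑ k f ≡ ∑ k g
∑-cong zero    eq = refl
∑-cong (suc k) eq = cong₂ _+_ (eq 0 z<s) (∑-cong k (λ i i<k → eq (suc i) (s<s i<k)))

∑-zero : ∀ k {f : ℕ → ℕ} → (∀ i → i < k → f i ≡ 0) → ∑ k f ≡ 0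
∑-zero zero    eq = refl
∑-zero (suc k) eq = cong₂ _+_ (eq 0 z<s) (∑-zero k (λ i i<k → eq (suc i) (s<s i<k)))

∑-ones : ∀ k {f : ℕ → ℕ} → (∀ i → i < k → f i ≡ 1) → ∑ k f ≡ k
∑-ones zero    eq = refl
∑-ones (suc k) eq = cong₂ _+_ (eq 0 z<s) (∑-ones k (λ i i<k → eq (suc i) (s<s i<k)))

∑-snoc : ∀ k (f : ℕ → ℕ) → ∑ (suc k) f ≡ ∑ k f + f k
∑-snoc zero    f = +-comm (f 0) 0
∑-snoc (suc k) f = trans (cong (f 0 +_) (∑-snoc k (λ i → f (suc i)))) (sym (+-assoc (f 0) _ _))

∑-split : ∀ a b (f : ℕ → ℕ) → ∑ (a + b) f ≡ ∑ a f + ∑ b (λ i → f (a + i))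
∑-split zero    b f = refl
∑-split (suc a) b f = trans (cong (f 0 +_) (∑-split a b (λ i → f (suc i)))) (sym (+-assoc (f 0) _ _))

-- extensions b c m counts the 321-avoiding continuations of length m of a
-- prefix having b free values between its last non-record and its maximum and
-- c free values above its maximum.  A free value below the maximum becomes the
-- new last non-record, keeping as gaps the j free values above it; the (j+1)-st
-- free value above the maximum becomes the new maximum, turning the j values it
-- skips into gaps.
extensions : ℕ → ℕ → ℕ → ℕ
extensions b c zero    = 1
extensions b c (suc m) = ∑ b (λ j → extensions j c m) + ∑ c (λ j → extensions (b + j) (c ∸ suc j) m)

extensions-tooLong : ∀ m b c → b + c < m → extensions b c m ≡ 0
extensions-tooLong (suc m) b c (s≤s b+c≤m) = cong₂ _+_
  (∑-zero b (λ j j<b → extensions-tooLong m j c (≤-trans (+-monoˡ-< c j<b) b+c≤m)))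
  (∑-zero c (λ j j<c → extensions-tooLong m (b + j) (c ∸ suc j) (subst (_≤ m) (sym (size j j<c)) b+c≤m)))
  where
  size : ∀ j → j < c → suc (b + j + (c ∸ suc j)) ≡ b + c
  size j j<c = begin
      suc (b + j + (c ∸ suc j))  ≡⟨ cong suc (+-assoc b j _) ⟩
      suc (b + (j + (c ∸ suc j))) ≡⟨ sym (+-suc b _) ⟩
      b + (suc j + (c ∸ suc j))  ≡⟨ cong (b +_) (m+[n∸m]≡n j<c) ⟩
      b + c                      ∎
    where open ≡-Reasoning

ballot : ℕ → ℕ → ℕ
ballot b c = extensions b c (b + c)

∑-extensions-last : ∀ b c → ∑ (suc b) (λ j → extensions j c (b + c)) ≡ ballot b c
∑-extensions-last b c = begin
    ∑ (suc b) (λ j → extensions j c (b + c))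
  ≡⟨ ∑-snoc b _ ⟩
    ∑ b (λ j → extensions j c (b + c)) + ballot b c
  ≡⟨ cong (_+ ballot b c) (∑-zero b (λ j j<b → extensions-tooLong (b + c) j c (+-monoˡ-< c j<b))) ⟩
    ballot b c ∎
  where open ≡-Reasoning

ballot-zero : ∀ b → ballot b 0 ≡ 1
ballot-zero zero    = refl
ballot-zero (suc b) = begin
    extensions (suc b) 0 (suc b + 0)       ≡⟨ cong (extensions (suc b) 0) (+-identityʳ (suc b)) ⟩
    ∑ (suc b) (λ j → extensions j 0 b) + 0  ≡⟨ +-identityʳ _ ⟩
    ∑ (suc b) (λ j → extensions j 0 b)      ≡⟨ cong (λ k → ∑ (suc b) (λ j → extensions j 0 k)) (sym (+-identityʳ b)) ⟩
    ∑ (suc b) (λ j → extensions j 0 (b + 0)) ≡⟨ ∑-extensions-last b 0 ⟩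
    ballot b 0                             ≡⟨ ballot-zero b ⟩
    1                                      ∎
  where open ≡-Reasoning

ballot-step : ∀ b c → ballot b (suc c) ≡ ∑ b (λ j → extensions j (suc c) (b + c)) + ballot (suc b) c
ballot-step b c = begin
    extensions b (suc c) (b + suc c)
  ≡⟨ cong (extensions b (suc c)) (+-suc b c) ⟩
    L + (extensions (b + 0) c (b + c) + R)
  ≡⟨ cong (λ b′ → L + (extensions b′ c (b + c) + R)) (+-identityʳ b) ⟩
    L + (ballot b c + R)
  ≡⟨ cong (λ x → L + (x + R)) (sym (∑-extensions-last b c)) ⟩
    L + (∑ (suc b) (λ j → extensions j c (b + c)) + R)
  ≡⟨ cong (λ x → L + (∑ (suc b) (λ j → extensions j c (b + c)) + x))
          (∑-cong c (λ j _ → cong (λ b′ → extensions b′ (c ∸ suc j) (b + c)) (+-suc b j))) ⟩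
    L + ballot (suc b) c ∎
  where
  open ≡-Reasoning
  L R : ℕ
  L = ∑ b (λ j → extensions j (suc c) (b + c))
  R = ∑ c (λ j → extensions (b + suc j) (c ∸ suc j) (b + c))

ballot-suc-suc : ∀ b c → ballot (suc b) (suc c) ≡ ballot b (suc c) + ballot (suc (suc b)) c
ballot-suc-suc b c = trans (ballot-step (suc b) c) (cong (_+ ballot (suc (suc b)) c) (begin
    ∑ (suc b) (λ j → extensions j (suc c) (suc b + c)) ≡⟨ cong (λ k → ∑ (suc b) (λ j → extensions j (suc c) k)) (sym (+-suc b c)) ⟩
    ∑ (suc b) (λ j → extensions j (suc c) (b + suc c)) ≡⟨ ∑-extensions-last b (suc c) ⟩
    ballot b (suc c) ∎))
  where open ≡-Reasoning

-- N C (c ∸ 1) except that it vanishes at c = 0.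
binomPrev : ℕ → ℕ → ℕ
binomPrev N zero    = 0
binomPrev N (suc c) = N C c

pascal : ∀ N c → suc N C c ≡ binomPrev N c + N C c
pascal N zero    = refl
pascal N (suc c) = sym (nCk+nC[k+1]≡[n+1]C[k+1] N c)

ballot-closedForm : ∀ c b → ballot b c + binomPrev (b + (c + c)) c ≡ (b + (c + c)) C c
ballot-closedForm zero    b = cong (_+ 0) (ballot-zero b)
ballot-closedForm (suc c) zero = begin
    ballot 0 (suc c) + binomPrev (suc c + suc c) (suc c) ≡⟨ cong₂ (λ x k → x + k C c) (ballot-step 0 c) N+2≡ ⟩
    ballot 1 c + suc N C c                               ≡⟨ cong (ballot 1 c +_) (pascal N c) ⟩
    ballot 1 c + (binomPrev N c + N C c)                 ≡⟨ sym (+-assoc (ballot 1 c) _ _) ⟩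
    (ballot 1 c + binomPrev N c) + N C c                 ≡⟨ cong (_+ N C c) (ballot-closedForm c 1) ⟩
    N C c + N C c                                        ≡⟨ cong (N C c +_) N-symmetric ⟩
    N C c + N C suc c                                    ≡⟨ nCk+nC[k+1]≡[n+1]C[k+1] N c ⟩
    suc N C suc c                                        ≡⟨ cong (_C suc c) (sym N+2≡) ⟩
    (suc c + suc c) C suc c                              ∎
  where
  open ≡-Reasoning
  N : ℕ
  N = suc (c + c)
  N+2≡ : suc c + suc c ≡ suc N
  N+2≡ = cong suc (+-suc c c)
  N-symmetric : N C c ≡ N C suc c
  N-symmetric = sym (trans (nCk≡nC[n∸k] (s≤s (m≤n+m c c))) (cong (N C_) (m+n∸n≡m c c)))
ballot-closedForm (suc c) (suc b) = begin
    ballot (suc b) (suc c) + suc N C c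
  ≡⟨ cong₂ _+_ (ballot-suc-suc b c) (pascal N c) ⟩
    (ballot b (suc c) + ballot (suc (suc b)) c) + (binomPrev N c + N C c)
  ≡⟨ interchange (ballot b (suc c)) (ballot (suc (suc b)) c) (binomPrev N c) (N C c) ⟩
    (ballot b (suc c) + N C c) + (ballot (suc (suc b)) c + binomPrev N c)
  ≡⟨ cong₂ _+_ (ballot-closedForm (suc c) b) outer ⟩
    N C suc c + N C c
  ≡⟨ +-comm (N C suc c) (N C c) ⟩
    N C c + N C suc c
  ≡⟨ nCk+nC[k+1]≡[n+1]C[k+1] N c ⟩
    suc N C suc c ∎
  where
  open ≡-Reasoning
  N : ℕ
  N = b + (suc c + suc c)
  N≡ : suc (suc b) + (c + c) ≡ N
  N≡ = solve 2 (λ b c → (con 2 :+ b) :+ (c :+ c) := b :+ ((con 1 :+ c) :+ (con 1 :+ c))) refl b c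
  interchange : ∀ w x y z → (w + x) + (y + z) ≡ (w + z) + (x + y)
  interchange = solve 4 (λ w x y z → (w :+ x) :+ (y :+ z) := (w :+ z) :+ (x :+ y)) refl
  outer : ballot (suc (suc b)) c + binomPrev N c ≡ N C c
  outer = subst (λ k → ballot (suc (suc b)) c + binomPrev k c ≡ k C c) N≡ (ballot-closedForm c (suc (suc b)))

C-absorption : ∀ n k → suc k * (suc n C suc k) ≡ suc n * (n C k)
C-absorption zero    zero    = refl
C-absorption zero    (suc k) = *-zeroʳ (suc (suc k))
C-absorption (suc n) zero    = trans (+-identityʳ _) (trans (nC1≡n (suc (suc n))) (sym (*-identityʳ (suc (suc n)))))
C-absorption (suc n) (suc k) = begin
    suc (suc k) * (suc (suc n) C suc (suc k))
  ≡⟨ cong (suc (suc k) *_) (sym (nCk+nC[k+1]≡[n+1]C[k+1] (suc n) (suc k))) ⟩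
    suc (suc k) * (suc n C suc k + suc n C suc (suc k))
  ≡⟨ expand (suc n C suc k) (suc n C suc (suc k)) ⟩
    (suc k * (suc n C suc k) + suc n C suc k) + suc (suc k) * (suc n C suc (suc k))
  ≡⟨ cong₂ (λ u v → (u + suc n C suc k) + v) (C-absorption n k) (C-absorption n (suc k)) ⟩
    (suc n * (n C k) + suc n C suc k) + suc n * (n C suc k)
  ≡⟨ collect (n C k) (suc n C suc k) (n C suc k) ⟩
    suc n * (n C k + n C suc k) + suc n C suc k
  ≡⟨ cong (λ z → suc n * z + suc n C suc k) (nCk+nC[k+1]≡[n+1]C[k+1] n k) ⟩
    suc n * (suc n C suc k) + suc n C suc k
  ≡⟨ +-comm (suc n * (suc n C suc k)) (suc n C suc k) ⟩
    suc (suc n) * (suc n C suc k) ∎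
  where
  open ≡-Reasoning
  expand : ∀ x y → suc (suc k) * (x + y) ≡ (suc k * x + x) + suc (suc k) * y
  expand = solve 3 (λ k x y → (con 2 :+ k) :* (x :+ y) := ((con 1 :+ k) :* x :+ x) :+ (con 2 :+ k) :* y) refl k
  collect : ∀ x y z → (suc n * x + y) + suc n * z ≡ suc n * (x + z) + y
  collect = solve 4 (λ n x y z → ((con 1 :+ n) :* x :+ y) :+ (con 1 :+ n) :* z := (con 1 :+ n) :* (x :+ z) :+ y) refl n

-- (k + 1) (N C (k + 1)) = (N − k) (N C k), with the subtraction moved across.
C-ratio : ∀ N k → suc k * (N C suc k) + k * (N C k) ≡ N * (N C k)
C-ratio N       zero    = trans (+-identityʳ _) (trans (+-identityʳ _) (trans (nC1≡n N) (sym (*-identityʳ N))))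
C-ratio zero    (suc k) = cong₂ _+_ (*-zeroʳ (suc (suc k))) (*-zeroʳ (suc k))
C-ratio (suc n) (suc k) = begin
    suc (suc k) * (suc n C suc (suc k)) + suc k * (suc n C suc k) ≡⟨ cong₂ _+_ (C-absorption n (suc k)) (C-absorption n k) ⟩
    suc n * (n C suc k) + suc n * (n C k)                         ≡⟨ sym (*-distribˡ-+ (suc n) (n C suc k) (n C k)) ⟩
    suc n * (n C suc k + n C k)                                   ≡⟨ cong (suc n *_) (+-comm (n C suc k) (n C k)) ⟩
    suc n * (n C k + n C suc k)                                   ≡⟨ cong (suc n *_) (nCk+nC[k+1]≡[n+1]C[k+1] n k) ⟩
    suc n * (suc n C suc k)                                       ∎
  where open ≡-Reasoning

binomPrev-central : ∀ c → suc c * binomPrev (c + c) c ≡ c * ((c + c) C c)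
binomPrev-central zero    = refl
binomPrev-central (suc c) = +-cancelʳ-≡ (c * X) _ _ (begin
    suc (suc c) * X + c * X              ≡⟨ sym (*-distribʳ-+ X (suc (suc c)) c) ⟩
    (suc (suc c) + c) * X                ≡⟨ cong (_* X) (solve 1 (λ c → (con 2 :+ c) :+ c := (con 1 :+ c) :+ (con 1 :+ c)) refl c) ⟩
    N * X                                ≡⟨ sym (C-ratio N c) ⟩
    suc c * (N C suc c) + c * X          ∎)
  where
  open ≡-Reasoning
  N X : ℕ
  N = suc c + suc c
  X = N C c

suc-*-ballot-central : ∀ c → suc c * ballot 0 c ≡ (c + c) C c
suc-*-ballot-central c = +-cancelʳ-≡ (c * B) _ _ (begin
    suc c * ballot 0 c + c * B                          ≡⟨ cong (suc c * ballot 0 c +_) (sym (binomPrev-central c)) ⟩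
    suc c * ballot 0 c + suc c * binomPrev (c + c) c    ≡⟨ sym (*-distribˡ-+ (suc c) (ballot 0 c) _) ⟩
    suc c * (ballot 0 c + binomPrev (c + c) c)          ≡⟨ cong (suc c *_) (ballot-closedForm c 0) ⟩
    suc c * B                                           ∎)
  where
  open ≡-Reasoning
  B : ℕ
  B = (c + c) C c

catalanPrev≡ballot : ∀ c → catalanPrev (suc c) ≡ ballot 0 c
catalanPrev≡ballot c = begin
    ((c + c) C c) / suc c        ≡⟨ cong (_/ suc c) (sym (suc-*-ballot-central c)) ⟩
    (suc c * ballot 0 c) / suc c ≡⟨ cong (_/ suc c) (*-comm (suc c) (ballot 0 c)) ⟩
    (ballot 0 c * suc c) / suc c ≡⟨ m*n/n≡m (ballot 0 c) (suc c) ⟩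
    ballot 0 c                   ∎
  where open ≡-Reasoning

≡true⇒T : ∀ {b} → b ≡ true → T b
≡true⇒T = Equivalence.from T-≡

T⇒≡true : ∀ {b} → T b → b ≡ true
T⇒≡true = Equivalence.to T-≡

<ᵇ≡true⇒< : ∀ m n → (m <ᵇ n) ≡ true → m < n
<ᵇ≡true⇒< m n h = <ᵇ⇒< m n (≡true⇒T h)

<⇒<ᵇ≡true : ∀ {m n} → m < n → (m <ᵇ n) ≡ true
<⇒<ᵇ≡true m<n = T⇒≡true (<⇒<ᵇ m<n)

≤⇒<ᵇ≡false : ∀ {m n} → n ≤ m → (m <ᵇ n) ≡ false
≤⇒<ᵇ≡false {m} {n} n≤m with m <ᵇ n in m<n
... | true  = contradiction (<ᵇ≡true⇒< m n m<n) (≤⇒≯ n≤m)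
... | false = refl

≡ᵇ≡true⇒≡ : ∀ m n → (m ≡ᵇ n) ≡ true → m ≡ n
≡ᵇ≡true⇒≡ m n h = ≡ᵇ⇒≡ m n (≡true⇒T h)

≡ᵇ-refl : ∀ n → (n ≡ᵇ n) ≡ true
≡ᵇ-refl n = T⇒≡true (≡⇒≡ᵇ n n refl)

≡ᵇ-sym : ∀ m n → (m ≡ᵇ n) ≡ (n ≡ᵇ m)
≡ᵇ-sym zero    zero    = refl
≡ᵇ-sym zero    (suc n) = refl
≡ᵇ-sym (suc m) zero    = refl
≡ᵇ-sym (suc m) (suc n) = ≡ᵇ-sym m n

<⇒≡ᵇ≡false : ∀ {m n} → m < n → (m ≡ᵇ n) ≡ false
<⇒≡ᵇ≡false {m} {n} m<n with m ≡ᵇ n in m≡n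
... | true  = contradiction (≡ᵇ≡true⇒≡ m n m≡n) (<⇒≢ m<n)
... | false = refl

>⇒≡ᵇ≡false : ∀ {m n} → n < m → (m ≡ᵇ n) ≡ false
>⇒≡ᵇ≡false {m} {n} n<m = trans (≡ᵇ-sym m n) (<⇒≡ᵇ≡false n<m)

<ᵇ-trichotomy : ∀ m n → (m <ᵇ n) ≡ not (m ≡ᵇ n) ∧ not (n <ᵇ m)
<ᵇ-trichotomy zero    zero    = refl
<ᵇ-trichotomy zero    (suc n) = refl
<ᵇ-trichotomy (suc m) zero    = refl
<ᵇ-trichotomy (suc m) (suc n) = <ᵇ-trichotomy m n

<ᵇ-trans : ∀ l m n → (l <ᵇ m) ≡ true → (m <ᵇ n) ≡ true → (l <ᵇ n) ≡ true
<ᵇ-trans l m n l<m m<n = <⇒<ᵇ≡true (<-trans (<ᵇ≡true⇒< l m l<m) (<ᵇ≡true⇒< m n m<n))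

<ᵇ-≤-trans : ∀ l m n → (l <ᵇ n) ≡ true → (m <ᵇ n) ≡ false → (l <ᵇ m) ≡ true
<ᵇ-≤-trans l m n l<n m≮n = <⇒<ᵇ≡true (<-≤-trans (<ᵇ≡true⇒< l n l<n) (≮⇒≥ λ m<n → contradiction (trans (sym (<⇒<ᵇ≡true m<n)) m≮n) λ ()))

fresh : List ℕ → ℕ → Bool
fresh S y = not (elemᵇ y S)

-- w continues, without repeated values or a 321, a prefix with value set S,
-- maximum M, and latest entry t among those below the running maximum.
admissible : List ℕ → ℕ → ℕ → List ℕ → Bool
admissible S t M []      = true
admissible S t M (x ∷ w) = fresh S x ∧ ((t <ᵇ x) ∧ (if x <ᵇ M then admissible (x ∷ S) x M w else admissible (x ∷ S) t x w))

compatible : List ℕ → ℕ → ℕ → List ℕ → Bool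
compatible S t M w = all (fresh S) w ∧ (all (t <ᵇ_) w ∧ not (has21below M w))

distinctAvoider : List ℕ → Bool
distinctAvoider w = distinct w ∧ avoids321 w

fresh-swap : ∀ e s a r → not (e ∨ s) ∧ (not a ∧ r) ≡ not (e ∨ a) ∧ (not s ∧ r)
fresh-swap true  _     _     _ = refl
fresh-swap false true  true  _ = refl
fresh-swap false true  false _ = refl
fresh-swap false false _     _ = refl

not∨-interchange : ∀ e l E L → (not e ∧ not l) ∧ (not E ∧ not L) ≡ not (e ∨ E) ∧ not (l ∨ L)
not∨-interchange true  _     _     _ = refl
not∨-interchange false true  true  _ = refl
not∨-interchange false true  false _ = refl
not∨-interchange false false _     _ = refl

all-fresh-[] : ∀ w → all (fresh []) w ≡ true
all-fresh-[] []      = refl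
all-fresh-[] (_ ∷ w) = all-fresh-[] w

all-fresh-∷ : ∀ x S w → all (fresh (x ∷ S)) w ≡ not (elemᵇ x w) ∧ all (fresh S) w
all-fresh-∷ x S []      = refl
all-fresh-∷ x S (y ∷ w) = trans
  (cong₂ (λ e r → not (e ∨ elemᵇ y S) ∧ r) (≡ᵇ-sym y x) (all-fresh-∷ x S w))
  (fresh-swap (x ≡ᵇ y) (elemᵇ y S) (elemᵇ x w) (all (fresh S) w))

all-above≡ : ∀ x w → all (x <ᵇ_) w ≡ not (elemᵇ x w) ∧ not (any (_<ᵇ x) w)
all-above≡ x []      = refl
all-above≡ x (y ∷ w) = trans (cong₂ _∧_ (<ᵇ-trichotomy x y) (all-above≡ x w))
  (not∨-interchange (x ≡ᵇ y) (y <ᵇ x) (elemᵇ x w) (any (_<ᵇ x) w))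

∨-true : ∀ a {b} → b ≡ true → a ∨ b ≡ true
∨-true a refl = ∨-zeroʳ a

has21below⇒any : ∀ x w → has21below x w ≡ true → any (_<ᵇ x) w ≡ true
has21below⇒any x (y ∷ w) h with y <ᵇ x
... | true  = refl
... | false = has21below⇒any x w h

has21below-mono : ∀ M x w → (x <ᵇ M) ≡ false → has21below M w ≡ true → has21below x w ≡ true
has21below-mono M x (y ∷ w) x≮M h with y <ᵇ M in y<M | any (_<ᵇ y) w
... | true  | true  rewrite <ᵇ-≤-trans y x M y<M x≮M = refl
... | true  | false = ∨-true _ (has21below-mono M x w x≮M h)
... | false | _     = ∨-true _ (has21below-mono M x w x≮M h)

all-above-weaken : ∀ t x w → (t <ᵇ x) ≡ true → all (x <ᵇ_) w ≡ true → all (t <ᵇ_) w ≡ true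
all-above-weaken t x []      t<x h = refl
all-above-weaken t x (y ∷ w) t<x h with x <ᵇ y in x<y
... | true rewrite <ᵇ-trans t x y t<x x<y = all-above-weaken t x w t<x h

-- Truth tables for admissible≡ and admissible-descent; the atoms abbreviate
-- eS = elemᵇ x S, tx = t <ᵇ x, ex = elemᵇ x w, dw = distinct w,
-- c = contains321 w, aS = all (fresh S) w, anyx = any (_<ᵇ x) w,
-- h21x = has21below x w, allt = all (t <ᵇ_) w.
admissible-below-table : ∀ eS tx ex dw c aS anyx h21x allt h21M →
  (h21x ≡ true → anyx ≡ true) → (tx ≡ true → ex ≡ false → anyx ≡ false → allt ≡ true) →
  not eS ∧ (tx ∧ ((dw ∧ not c) ∧ ((not ex ∧ aS) ∧ ((not ex ∧ not anyx) ∧ not h21M))))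
    ≡ ((not ex ∧ dw) ∧ not (h21x ∨ c)) ∧ ((not eS ∧ aS) ∧ ((tx ∧ allt) ∧ not (anyx ∨ h21M)))
admissible-below-table true  _     true  _     _     _     _     _     _     _     _         _ = refl
admissible-below-table true  _     false true  _     _     _     true  _     _     _         _ = refl
admissible-below-table true  _     false true  true  _     _     false _     _     _         _ = refl
admissible-below-table true  _     false true  false _     _     false _     _     _         _ = refl
admissible-below-table true  _     false false _     _     _     _     _     _     _         _ = refl
admissible-below-table false true  true  true  true  _     _     _     _     _     _         _ = refl
admissible-below-table false true  false true  true  _     _     true  _     _     _         _ = refl
admissible-below-table false true  false true  true  _     _     false _     _     _         _ = refl
admissible-below-table false true  true  true  false _     _     _     _     _     _         _ = refl
admissible-below-table false true  false true  false true  true  true  _     _     _         _ = refl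
admissible-below-table false true  false true  false true  true  false true  _     _         _ = refl
admissible-below-table false true  false true  false true  true  false false _     _         _ = refl
admissible-below-table false true  false true  false true  false true  _     true  h21x⇒anyx _ = contradiction (h21x⇒anyx refl) λ ()
admissible-below-table false true  false true  false true  false false true  true  _         _ = refl
admissible-below-table false true  false true  false true  false false false true  _         ⇒allt = contradiction (⇒allt refl refl refl) λ ()
admissible-below-table false true  false true  false true  false true  _     false h21x⇒anyx _ = contradiction (h21x⇒anyx refl) λ ()
admissible-below-table false true  false true  false true  false false true  false _         _ = refl
admissible-below-table false true  false true  false true  false false false false _         ⇒allt = contradiction (⇒allt refl refl refl) λ ()
admissible-below-table false true  false true  false false _     true  _     _     _         _ = refl
admissible-below-table false true  false true  false false _     false _     _     _         _ = refl
admissible-below-table false true  true  false _     _     _     _     _     _     _         _ = refl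
admissible-below-table false true  false false _     _     _     _     _     _     _         _ = refl
admissible-below-table false false true  _     _     _     _     _     _     _     _         _ = refl
admissible-below-table false false false true  _     _     _     true  _     _     _         _ = refl
admissible-below-table false false false true  true  _     _     false _     _     _         _ = refl
admissible-below-table false false false true  false true  _     false _     _     _         _ = refl
admissible-below-table false false false true  false false _     false _     _     _         _ = refl
admissible-below-table false false false false _     _     _     _     _     _     _         _ = refl

admissible-newMax-table : ∀ eS tx ex dw c aS h21x allt h21M →
  (h21M ≡ true → h21x ≡ true) →
  not eS ∧ (tx ∧ ((dw ∧ not c) ∧ ((not ex ∧ aS) ∧ (allt ∧ not h21x))))
    ≡ ((not ex ∧ dw) ∧ not (h21x ∨ c)) ∧ ((not eS ∧ aS) ∧ ((tx ∧ allt) ∧ not h21M))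
admissible-newMax-table true  _     true  _     _     _     _     _     _     _ = refl
admissible-newMax-table true  _     false true  _     _     true  _     _     _ = refl
admissible-newMax-table true  _     false true  true  _     false _     _     _ = refl
admissible-newMax-table true  _     false true  false _     false _     _     _ = refl
admissible-newMax-table true  _     false false _     _     _     _     _     _ = refl
admissible-newMax-table false true  true  true  true  _     _     _     _     _ = refl
admissible-newMax-table false true  false true  true  _     true  _     _     _ = refl
admissible-newMax-table false true  false true  true  _     false _     _     _ = refl
admissible-newMax-table false true  true  true  false _     _     _     _     _ = refl
admissible-newMax-table false true  false true  false true  true  true  _     _ = refl
admissible-newMax-table false true  false true  false true  false true  true  h21M⇒h21x = contradiction (h21M⇒h21x refl) λ ()
admissible-newMax-table false true  false true  false true  false true  false _ = refl
admissible-newMax-table false true  false true  false true  true  false _     _ = refl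
admissible-newMax-table false true  false true  false true  false false _     _ = refl
admissible-newMax-table false true  false true  false false true  _     _     _ = refl
admissible-newMax-table false true  false true  false false false _     _     _ = refl
admissible-newMax-table false true  true  false _     _     _     _     _     _ = refl
admissible-newMax-table false true  false false _     _     _     _     _     _ = refl
admissible-newMax-table false false true  _     _     _     _     _     _     _ = refl
admissible-newMax-table false false false true  _     _     true  _     _     _ = refl
admissible-newMax-table false false false true  true  _     false _     _     _ = refl
admissible-newMax-table false false false true  false true  false _     _     _ = refl
admissible-newMax-table false false false true  false false false _     _     _ = refl
admissible-newMax-table false false false false _     _     _     _     _     _ = refl

admissible≡ : ∀ S t M w → admissible S t M w ≡ distinctAvoider w ∧ compatible S t M w
admissible≡ S t M []      = refl
admissible≡ S t M (x ∷ w) with x <ᵇ M in x<M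
... | true  = trans (cong (λ r → fresh S x ∧ ((t <ᵇ x) ∧ r)) tail≡)
  (admissible-below-table (elemᵇ x S) (t <ᵇ x) (elemᵇ x w) (distinct w) (contains321 w) (all (fresh S) w)
     (any (_<ᵇ x) w) (has21below x w) (all (t <ᵇ_) w) (has21below M w)
     (has21below⇒any x w)
     (λ t<x x∉w none<x → all-above-weaken t x w t<x (trans (all-above≡ x w) (cong₂ (λ e a → not e ∧ not a) x∉w none<x))))
  where
  tail≡ : admissible (x ∷ S) x M w
          ≡ distinctAvoider w ∧ ((not (elemᵇ x w) ∧ all (fresh S) w) ∧ ((not (elemᵇ x w) ∧ not (any (_<ᵇ x) w)) ∧ not (has21below M w)))
  tail≡ = trans (admissible≡ (x ∷ S) x M w)
    (cong₂ (λ f a → distinctAvoider w ∧ (f ∧ (a ∧ not (has21below M w)))) (all-fresh-∷ x S w) (all-above≡ x w))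
... | false = trans (cong (λ r → fresh S x ∧ ((t <ᵇ x) ∧ r)) tail≡)
  (admissible-newMax-table (elemᵇ x S) (t <ᵇ x) (elemᵇ x w) (distinct w) (contains321 w) (all (fresh S) w)
     (has21below x w) (all (t <ᵇ_) w) (has21below M w)
     (has21below-mono M x w x<M))
  where
  tail≡ : admissible (x ∷ S) t x w
          ≡ distinctAvoider w ∧ ((not (elemᵇ x w) ∧ all (fresh S) w) ∧ (all (t <ᵇ_) w ∧ not (has21below x w)))
  tail≡ = trans (admissible≡ (x ∷ S) t x w)
    (cong (λ f → distinctAvoider w ∧ (f ∧ (all (t <ᵇ_) w ∧ not (has21below x w)))) (all-fresh-∷ x S w))

admissible-descent-table : ∀ ex ey dw anyy h21x h21y c → (h21y ≡ true → anyy ≡ true) →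
  (dw ∧ not c) ∧ ((not ey ∧ (not ex ∧ true)) ∧ ((not ey ∧ not anyy) ∧ not h21x))
    ≡ (not ex ∧ (not ey ∧ dw)) ∧ not ((anyy ∨ h21x) ∨ (h21y ∨ c))
admissible-descent-table true  _     true  _     _     _     true  _ = refl
admissible-descent-table false true  true  _     _     _     true  _ = refl
admissible-descent-table false false true  true  _     _     true  _ = refl
admissible-descent-table false false true  false true  _     true  _ = refl
admissible-descent-table false false true  false false true  true  h21y⇒anyy = contradiction (h21y⇒anyy refl) λ ()
admissible-descent-table false false true  false false false true  _ = refl
admissible-descent-table true  true  true  _     _     _     false _ = refl
admissible-descent-table false true  true  _     _     _     false _ = refl
admissible-descent-table true  false true  _     _     _     false _ = refl
admissible-descent-table false false true  true  _     _     false _ = refl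
admissible-descent-table false false true  false true  _     false _ = refl
admissible-descent-table false false true  false false true  false h21y⇒anyy = contradiction (h21y⇒anyy refl) λ ()
admissible-descent-table false false true  false false false false _ = refl
admissible-descent-table true  _     false _     _     _     _     _ = refl
admissible-descent-table false true  false _     _     _     _     _ = refl
admissible-descent-table false false false _     _     _     _     _ = refl

admissible-descent : ∀ x y w → (y <ᵇ x) ≡ true → admissible (y ∷ x ∷ []) y x w ≡ distinctAvoider (x ∷ y ∷ w)
admissible-descent x y w y<x = begin
    admissible (y ∷ x ∷ []) y x w
  ≡⟨ admissible≡ (y ∷ x ∷ []) y x w ⟩
    distinctAvoider w ∧ (all (fresh (y ∷ x ∷ [])) w ∧ (all (y <ᵇ_) w ∧ not (has21below x w)))
  ≡⟨ cong₂ (λ f a → distinctAvoider w ∧ (f ∧ (a ∧ not (has21below x w)))) fresh-yx (all-above≡ y w) ⟩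
    distinctAvoider w ∧ ((not (elemᵇ y w) ∧ (not (elemᵇ x w) ∧ true)) ∧ ((not (elemᵇ y w) ∧ not (any (_<ᵇ y) w)) ∧ not (has21below x w)))
  ≡⟨ admissible-descent-table (elemᵇ x w) (elemᵇ y w) (distinct w) (any (_<ᵇ y) w) (has21below x w) (has21below y w)
       (contains321 w) (has21below⇒any y w) ⟩
    (not (elemᵇ x w) ∧ (not (elemᵇ y w) ∧ distinct w)) ∧ not ((any (_<ᵇ y) w ∨ has21below x w) ∨ (has21below y w ∨ contains321 w))
  ≡⟨ sym (cong₂ (λ e d → (not (e ∨ elemᵇ x w) ∧ (not (elemᵇ y w) ∧ distinct w))
                          ∧ not (((d ∧ any (_<ᵇ y) w) ∨ has21below x w) ∨ (has21below y w ∨ contains321 w)))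
                (>⇒≡ᵇ≡false (<ᵇ≡true⇒< y x y<x)) y<x) ⟩
    distinctAvoider (x ∷ y ∷ w) ∎
  where
  open ≡-Reasoning
  fresh-yx : all (fresh (y ∷ x ∷ [])) w ≡ not (elemᵇ y w) ∧ (not (elemᵇ x w) ∧ true)
  fresh-yx = trans (all-fresh-∷ y (x ∷ []) w)
    (cong (not (elemᵇ y w) ∧_) (trans (all-fresh-∷ x [] w) (cong (not (elemᵇ x w) ∧_) (all-fresh-[] w))))

-- The first ascent of a 321-avoider is at position 1 or 2.
isDesarrangement∧avoids321≡descent : ∀ x y w → isDesarrangement (x ∷ y ∷ w) ∧ avoids321 (x ∷ y ∷ w) ≡ (y <ᵇ x) ∧ avoids321 (x ∷ y ∷ w)
isDesarrangement∧avoids321≡descent x y [] with y <ᵇ x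
... | true  = refl
... | false = refl
isDesarrangement∧avoids321≡descent x y (z ∷ w) with y <ᵇ x | z <ᵇ y
... | false | _     = refl
... | true  | false = refl
... | true  | true  = ∧-zeroʳ _

desarrangementAvoider≡admissible : ∀ x y w → distinct (x ∷ y ∷ w) ∧ (isDesarrangement (x ∷ y ∷ w) ∧ avoids321 (x ∷ y ∷ w))
                                    ≡ (y <ᵇ x) ∧ admissible (y ∷ x ∷ []) y x w
desarrangementAvoider≡admissible x y w = trans (cong (distinct π ∧_) (isDesarrangement∧avoids321≡descent x y w)) (byDescent (y <ᵇ x) refl)
  where
  π : List ℕ
  π = x ∷ y ∷ w
  byDescent : ∀ b → (y <ᵇ x) ≡ b → distinct π ∧ ((y <ᵇ x) ∧ avoids321 π) ≡ (y <ᵇ x) ∧ admissible (y ∷ x ∷ []) y x w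
  byDescent true  y<x = trans (cong (λ b → distinct π ∧ (b ∧ avoids321 π)) y<x)
                              (trans (sym (admissible-descent x y w y<x)) (cong (_∧ admissible (y ∷ x ∷ []) y x w) (sym y<x)))
  byDescent false y≮x = trans (cong (λ b → distinct π ∧ (b ∧ avoids321 π)) y≮x)
                              (trans (∧-zeroʳ (distinct π)) (cong (_∧ admissible (y ∷ x ∷ []) y x w) (sym y≮x)))

indicator : Bool → ℕ
indicator b = if b then 1 else 0

countᵇ : ∀ {A : Set} → (A → Bool) → List A → ℕ
countᵇ p xs = length (filterᵇ p xs)

countᵇ-++ : ∀ {A : Set} (p : A → Bool) xs ys → countᵇ p (xs ++ ys) ≡ countᵇ p xs + countᵇ p ys
countᵇ-++ p xs ys = trans (cong length (filter-++ _ xs ys)) (length-++ (filterᵇ p xs))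

countᵇ-false : ∀ {A : Set} (xs : List A) → countᵇ (λ _ → false) xs ≡ 0
countᵇ-false []       = refl
countᵇ-false (_ ∷ xs) = countᵇ-false xs

countᵇ-cong : ∀ {A : Set} {p q : A → Bool} xs → (∀ x → p x ≡ q x) → countᵇ p xs ≡ countᵇ q xs
countᵇ-cong                 []       eq = refl
countᵇ-cong {p = p} {q} (x ∷ xs) eq with p x | q x | eq x
... | true  | .true  | refl = cong suc (countᵇ-cong xs eq)
... | false | .false | refl = countᵇ-cong xs eq

countᵇ-map-∷ : ∀ (p : List ℕ → Bool) x ws → countᵇ p (map (x ∷_) ws) ≡ countᵇ (λ w → p (x ∷ w)) ws
countᵇ-map-∷ p x []       = refl
countᵇ-map-∷ p x (w ∷ ws) with p (x ∷ w)
... | true  = cong suc (countᵇ-map-∷ p x ws)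
... | false = countᵇ-map-∷ p x ws

countᵇ-filterᵇ : ∀ {A : Set} (p q : A → Bool) xs → countᵇ p (filterᵇ q xs) ≡ countᵇ (λ x → q x ∧ p x) xs
countᵇ-filterᵇ p q []       = refl
countᵇ-filterᵇ p q (x ∷ xs) with q x
... | false = countᵇ-filterᵇ p q xs
... | true with p x
...   | true  = cong suc (countᵇ-filterᵇ p q xs)
...   | false = countᵇ-filterᵇ p q xs

∑-tabulate : ∀ n (g : ℕ → ℕ) → sum (tabulate {n = n} (λ i → g (toℕ i))) ≡ ∑ n g
∑-tabulate zero    g = refl
∑-tabulate (suc n) g = cong (g 0 +_) (∑-tabulate n (λ i → g (suc i)))

countᵇ-words-suc : ∀ n m (p : List ℕ → Bool) → countᵇ p (words n (suc m)) ≡ ∑ n (λ i → countᵇ (λ w → p (suc i ∷ w)) (words n m))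
countᵇ-words-suc n m p = begin
    countᵇ p (concatMap (λ x → map (x ∷_) W) (map value (allFin n)))
  ≡⟨ countᵇ-concatMap (map value (allFin n)) ⟩
    sum (map first (map value (allFin n)))
  ≡⟨ cong sum (sym (map-∘ (allFin n))) ⟩
    sum (map (λ i → first (value i)) (tabulate (λ i → i)))
  ≡⟨ cong sum (map-tabulate (λ i → i) (λ i → first (value i))) ⟩
    sum (tabulate (λ i → first (value i)))
  ≡⟨ ∑-tabulate n (λ i → first (suc i)) ⟩
    ∑ n (λ i → first (suc i)) ∎
  where
  open ≡-Reasoning
  W : List (List ℕ)
  W = words n m
  value : Fin n → ℕ
  value i = suc (toℕ i)
  first : ℕ → ℕ
  first x = countᵇ (λ w → p (x ∷ w)) W
  countᵇ-concatMap : ∀ xs → countᵇ p (concatMap (λ x → map (x ∷_) W) xs) ≡ sum (map first xs)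
  countᵇ-concatMap []       = refl
  countᵇ-concatMap (x ∷ xs) = trans (countᵇ-++ p (map (x ∷_) W) _) (cong₂ _+_ (countᵇ-map-∷ p x W) (countᵇ-concatMap xs))

-- Every marked position in [lo, lo + r) contributes F of the number of marked
-- positions above it, and these numbers run through 0, 1, …, (#marked − 1).
∑-byRank : ∀ (u : ℕ → Bool) (F : ℕ → ℕ) r lo →
  ∑ r (λ i → if u (lo + i) then F (∑ (r ∸ suc i) (λ k → indicator (u (suc (lo + i) + k)))) else 0)
    ≡ ∑ (∑ r (λ i → indicator (u (lo + i)))) F
∑-byRank u F zero    lo = refl
∑-byRank u F (suc r) lo = begin
    (if u (lo + 0) then F (∑ r (λ k → indicator (u (suc (lo + 0) + k)))) else 0) + ∑ r rest
  ≡⟨ cong₂ _+_ (cong (λ l → if u l then F (∑ r (λ k → indicator (u (suc l + k)))) else 0) (+-identityʳ lo)) restEq ⟩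
    (if u lo then F above else 0) + ∑ above F
  ≡⟨ prepend (u lo) ⟩
    ∑ (indicator (u lo) + above) F
  ≡⟨ cong (λ l → ∑ (indicator (u l) + above) F) (sym (+-identityʳ lo)) ⟩
    ∑ (indicator (u (lo + 0)) + above) F
  ≡⟨ cong (λ a → ∑ (indicator (u (lo + 0)) + a) F) (∑-cong r (λ i _ → cong (λ l → indicator (u l)) (sym (+-suc lo i)))) ⟩
    ∑ (∑ (suc r) (λ i → indicator (u (lo + i)))) F ∎
  where
  open ≡-Reasoning
  above : ℕ
  above = ∑ r (λ i → indicator (u (suc lo + i)))
  rest : ℕ → ℕ
  rest i = if u (lo + suc i) then F (∑ (r ∸ suc i) (λ k → indicator (u (suc (lo + suc i) + k)))) else 0
  restEq : ∑ r rest ≡ ∑ above F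
  restEq = trans (∑-cong r (λ i _ → cong (λ l → if u l then F (∑ (r ∸ suc i) (λ k → indicator (u (suc l + k)))) else 0) (+-suc lo i)))
                 (∑-byRank u F r (suc lo))
  prepend : ∀ b → (if b then F above else 0) + ∑ above F ≡ ∑ (indicator b + above) F
  prepend true  = trans (+-comm (F above) (∑ above F)) (sym (∑-snoc above F))
  prepend false = refl

module Completions (n : ℕ) where

  completions : List ℕ → ℕ → ℕ → ℕ → ℕ
  completions S t M m = countᵇ (admissible S t M) (words n m)

  completionsFrom : List ℕ → ℕ → ℕ → ℕ → ℕ → ℕ
  completionsFrom S t M m x =
    if fresh S x ∧ (t <ᵇ x) then (if x <ᵇ M then completions (x ∷ S) x M m else completions (x ∷ S) t x m) else 0

  completions-suc : ∀ S t M m → completions S t M (suc m) ≡ ∑ n (λ i → completionsFrom S t M m (suc i))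
  completions-suc S t M m = trans (countᵇ-words-suc n m (admissible S t M)) (∑-cong n (λ i _ → startingWith (suc i)))
    where
    startingWith : ∀ x → countᵇ (λ w → admissible S t M (x ∷ w)) (words n m) ≡ completionsFrom S t M m x
    startingWith x with fresh S x | t <ᵇ x | x <ᵇ M
    ... | true  | true  | true  = refl
    ... | true  | true  | false = refl
    ... | true  | false | _     = countᵇ-false (words n m)
    ... | false | _     | _     = countᵇ-false (words n m)

  gaps : List ℕ → ℕ → ℕ → ℕ
  gaps S t M = ∑ (M ∸ suc t) (λ i → indicator (fresh S (suc t + i)))

  record Valid (S : List ℕ) (t M : ℕ) : Set where
    field
      t<M : t < M
      M∈S : elemᵇ M S ≡ true
      S≤M : ∀ y → elemᵇ y S ≡ true → y ≤ M
      M≤n : M ≤ n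
  open Valid

  ∉-above : ∀ {S t M x} → Valid S t M → M < x → elemᵇ x S ≡ false
  ∉-above {S} {x = x} v M<x with elemᵇ x S in x∈S
  ... | true  = contradiction (S≤M v x x∈S) (<⇒≱ M<x)
  ... | false = refl

  ∷-bounded : ∀ S {x B} → x ≤ B → (∀ y → elemᵇ y S ≡ true → y ≤ B) → ∀ y → elemᵇ y (x ∷ S) ≡ true → y ≤ B
  ∷-bounded S {x} x≤B S≤B y y∈xS with y ≡ᵇ x in y≡x
  ... | true  = subst (_≤ _) (sym (≡ᵇ≡true⇒≡ y x y≡x)) x≤B
  ... | false = S≤B y y∈xS

  valid-newMax : ∀ {S t M x} → Valid S t M → M < x → x ≤ n → Valid (x ∷ S) t x
  valid-newMax {S} {x = x} v M<x x≤n = record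
    { t<M = <-trans (t<M v) M<x
    ; M∈S = cong (_∨ elemᵇ x S) (≡ᵇ-refl x)
    ; S≤M = ∷-bounded S ≤-refl (λ y y∈S → ≤-trans (S≤M v y y∈S) (<⇒≤ M<x))
    ; M≤n = x≤n
    }

  valid-gap : ∀ {S t M x} → Valid S t M → x < M → Valid (x ∷ S) x M
  valid-gap {S} {M = M} {x} v x<M = record
    { t<M = x<M
    ; M∈S = ∨-true (M ≡ᵇ x) (M∈S v)
    ; S≤M = ∷-bounded S (<⇒≤ x<M) (S≤M v)
    ; M≤n = M≤n v
    }

  completionsFrom-newMax : ∀ {S t M} m {x} → Valid S t M → M < x → completionsFrom S t M m x ≡ completions (x ∷ S) t x m
  completionsFrom-newMax m v M<x
    rewrite ∉-above v M<x | <⇒<ᵇ≡true (<-trans (t<M v) M<x) | ≤⇒<ᵇ≡false (<⇒≤ M<x) = refl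

  completionsFrom-gap : ∀ {S t M} m {x} → t < x → x < M → completionsFrom S t M m x ≡ (if fresh S x then completions (x ∷ S) x M m else 0)
  completionsFrom-gap {S} m {x} t<x x<M rewrite <⇒<ᵇ≡true t<x | <⇒<ᵇ≡true x<M with fresh S x
  ... | true  = refl
  ... | false = refl

  completionsFrom-low : ∀ {S t M} m {x} → x ≤ t → completionsFrom S t M m x ≡ 0
  completionsFrom-low {S} m {x} x≤t rewrite ≤⇒<ᵇ≡false x≤t with fresh S x
  ... | true  = refl
  ... | false = refl

  completionsFrom-max : ∀ {S t M} m → Valid S t M → completionsFrom S t M m M ≡ 0
  completionsFrom-max m v rewrite M∈S v = refl

  gaps-∷-self : ∀ S x M → gaps (x ∷ S) x M ≡ ∑ (M ∸ suc x) (λ k → indicator (fresh S (suc x + k)))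
  gaps-∷-self S x M = ∑-cong (M ∸ suc x) (λ k _ →
    cong (λ e → indicator (not (e ∨ elemᵇ (suc x + k) S))) (>⇒≡ᵇ≡false (s≤s (m≤m+n x k))))

  -- The gaps below the new maximum x are the old ones and the i free values
  -- strictly between M and x; M itself is used.
  gaps-newMax : ∀ {S t M} i → Valid S t M → gaps (suc (M + i) ∷ S) t (suc (M + i)) ≡ gaps S t M + i
  gaps-newMax {S} {t} {M} i v = begin
      ∑ (x ∸ suc t) g                                    ≡⟨ cong (λ k → ∑ k g) x∸t ⟩
      ∑ (r + suc i) g                                    ≡⟨ ∑-split r (suc i) g ⟩
      ∑ r g + (g (r + 0) + ∑ i (λ k → g (r + suc k)))    ≡⟨ cong₂ _+_ old (cong₂ _+_ atM between) ⟩
      gaps S t M + (0 + i)                               ∎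
    where
    open ≡-Reasoning
    x r : ℕ
    x = suc (M + i)
    r = M ∸ suc t
    g : ℕ → ℕ
    g k = indicator (fresh (x ∷ S) (suc t + k))
    t+r≡M : suc t + r ≡ M
    t+r≡M = m+[n∸m]≡n (t<M v)
    x∸t : x ∸ suc t ≡ r + suc i
    x∸t = begin
      suc (M + i) ∸ suc t              ≡⟨ cong (λ y → suc (y + i) ∸ suc t) (sym t+r≡M) ⟩
      suc (suc t + r + i) ∸ suc t      ≡⟨ cong (_∸ suc t) (cong suc (+-assoc (suc t) r i)) ⟩
      suc (suc t + (r + i)) ∸ suc t    ≡⟨ cong (_∸ suc t) (sym (+-suc (suc t) (r + i))) ⟩
      (suc t + suc (r + i)) ∸ suc t    ≡⟨ m+n∸m≡n (suc t) (suc (r + i)) ⟩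
      suc (r + i)                      ≡⟨ sym (+-suc r i) ⟩
      r + suc i                        ∎
    old : ∑ r g ≡ gaps S t M
    old = ∑-cong r (λ k k<r → cong (λ e → indicator (not (e ∨ elemᵇ (suc t + k) S)))
      (<⇒≡ᵇ≡false (<-trans (subst (suc t + k <_) t+r≡M (+-monoʳ-< (suc t) k<r)) (s≤s (m≤m+n M i)))))
    atM : g (r + 0) ≡ 0
    atM = trans (cong (λ y → indicator (fresh (x ∷ S) y)) (trans (cong (suc t +_) (+-identityʳ r)) t+r≡M))
                (cong (λ e → indicator (not e)) (∨-true (M ≡ᵇ x) (M∈S v)))
    between : ∑ i (λ k → g (r + suc k)) ≡ i
    between = ∑-ones i (λ k k<i → trans
      (cong (λ y → indicator (fresh (x ∷ S) y)) (trans (sym (+-assoc (suc t) r (suc k))) (cong (_+ suc k) t+r≡M)))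
      (cong (λ e → indicator (not e)) (cong₂ _∨_
        (<⇒≡ᵇ≡false (subst (_< x) (sym (+-suc M k)) (s≤s (+-monoʳ-< M k<i))))
        (∉-above v (m<m+n M z<s)))))

  Counted : ℕ → Set
  Counted m = ∀ S t M → Valid S t M → completions S t M m ≡ extensions (gaps S t M) (n ∸ M) m

  completionsFrom-newMax-counted : ∀ m → Counted m → ∀ {S t M} → Valid S t M → ∀ i → i < n ∸ M →
    completionsFrom S t M m (suc (M + i)) ≡ extensions (gaps S t M + i) ((n ∸ M) ∸ suc i) m
  completionsFrom-newMax-counted m counted {S} {t} {M} v i i<n∸M = begin
      completionsFrom S t M m x                 ≡⟨ completionsFrom-newMax m v M<x ⟩
      completions (x ∷ S) t x m                 ≡⟨ counted (x ∷ S) t x (valid-newMax v M<x x≤n) ⟩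
      extensions (gaps (x ∷ S) t x) (n ∸ x) m   ≡⟨ cong₂ (λ b c → extensions b c m) (gaps-newMax i v) n∸x ⟩
      extensions (gaps S t M + i) ((n ∸ M) ∸ suc i) m ∎
    where
    open ≡-Reasoning
    x : ℕ
    x = suc (M + i)
    M<x : M < x
    M<x = s≤s (m≤m+n M i)
    x≤n : x ≤ n
    x≤n = subst (x ≤_) (m+[n∸m]≡n (M≤n v)) (+-monoʳ-< M i<n∸M)
    n∸x : n ∸ x ≡ (n ∸ M) ∸ suc i
    n∸x = sym (trans (∸-+-assoc n M (suc i)) (cong (n ∸_) (+-suc M i)))

  ∑-completionsFrom-below : ∀ m → Counted m → ∀ {S t M} → Valid S t M →
    ∑ M (λ i → completionsFrom S t M m (suc i)) ≡ ∑ (gaps S t M) (λ j → extensions j (n ∸ M) m)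
  ∑-completionsFrom-below m counted {S} {t} {M} v = begin
      ∑ M f                                       ≡⟨ cong (λ k → ∑ k f) M≡t+r+1 ⟩
      ∑ (t + suc r) f                             ≡⟨ ∑-split t (suc r) f ⟩
      ∑ t f + ∑ (suc r) (λ i → f (t + i))          ≡⟨ cong₂ _+_ (∑-zero t (λ i i<t → completionsFrom-low {S} {t} {M} m i<t)) (∑-snoc r _) ⟩
      ∑ r (λ i → f (t + i)) + f (t + r)            ≡⟨ cong (∑ r (λ i → f (t + i)) +_) atM ⟩
      ∑ r (λ i → f (t + i)) + 0                    ≡⟨ +-identityʳ _ ⟩
      ∑ r (λ i → f (t + i))                        ≡⟨ ∑-cong r atGap ⟩
      ∑ r (λ i → if u (suc t + i) then F (∑ (r ∸ suc i) (λ k → indicator (u (suc (suc t + i) + k)))) else 0)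
                                                  ≡⟨ ∑-byRank u F r (suc t) ⟩
      ∑ (gaps S t M) F                            ∎
    where
    open ≡-Reasoning
    f : ℕ → ℕ
    f i = completionsFrom S t M m (suc i)
    u : ℕ → Bool
    u = fresh S
    F : ℕ → ℕ
    F j = extensions j (n ∸ M) m
    r : ℕ
    r = M ∸ suc t
    t+r≡M : suc t + r ≡ M
    t+r≡M = m+[n∸m]≡n (t<M v)
    M≡t+r+1 : M ≡ t + suc r
    M≡t+r+1 = trans (sym t+r≡M) (sym (+-suc t r))
    atM : f (t + r) ≡ 0
    atM = trans (cong (completionsFrom S t M m) t+r≡M) (completionsFrom-max m v)
    atGap : ∀ i → i < r → f (t + i) ≡ (if u (suc t + i) then F (∑ (r ∸ suc i) (λ k → indicator (u (suc (suc t + i) + k)))) else 0)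
    atGap i i<r = trans (completionsFrom-gap {S} {t} {M} m (s≤s (m≤m+n t i)) x<M)
                        (cong (λ c → if u x then c else 0) (trans (counted (x ∷ S) x M (valid-gap v x<M)) (cong F gapsAbove)))
      where
      x : ℕ
      x = suc t + i
      x<M : x < M
      x<M = subst (x <_) t+r≡M (+-monoʳ-< (suc t) i<r)
      gapsAbove : gaps (x ∷ S) x M ≡ ∑ (r ∸ suc i) (λ k → indicator (u (suc x + k)))
      gapsAbove = trans (gaps-∷-self S x M)
        (cong (λ k → ∑ k (λ k → indicator (u (suc x + k))))
              (trans (cong₂ _∸_ (sym t+r≡M) (sym (+-suc (suc t) i))) ([m+n]∸[m+o]≡n∸o (suc t) r (suc i))))

  completions≡extensions : ∀ m → Counted m
  completions≡extensions zero    S t M v = refl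
  completions≡extensions (suc m) S t M v = begin
      completions S t M (suc m)                  ≡⟨ completions-suc S t M m ⟩
      ∑ n f                                      ≡⟨ cong (λ k → ∑ k f) (sym (m+[n∸m]≡n (M≤n v))) ⟩
      ∑ (M + (n ∸ M)) f                          ≡⟨ ∑-split M (n ∸ M) f ⟩
      ∑ M f + ∑ (n ∸ M) (λ i → f (M + i))        ≡⟨ cong₂ _+_ (∑-completionsFrom-below m counted v)
                                                              (∑-cong (n ∸ M) (completionsFrom-newMax-counted m counted v)) ⟩
      extensions (gaps S t M) (n ∸ M) (suc m)    ∎
    where
    open ≡-Reasoning
    counted : Counted m
    counted = completions≡extensions m
    f : ℕ → ℕ
    f i = completionsFrom S t M m (suc i)

∸-+-∸ : ∀ {a x n} → a ≤ x → x ≤ n → (x ∸ a) + (n ∸ x) ≡ n ∸ a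
∸-+-∸ {a} {x} {n} a≤x x≤n = begin
    (x ∸ a) + (n ∸ x)   ≡⟨ +-comm (x ∸ a) (n ∸ x) ⟩
    (n ∸ x) + (x ∸ a)   ≡⟨ sym (+-∸-assoc (n ∸ x) a≤x) ⟩
    (n ∸ x) + x ∸ a     ≡⟨ cong (_∸ a) (m∸n+n≡m x≤n) ⟩
    n ∸ a               ∎
  where open ≡-Reasoning

module Desarrangements (k : ℕ) where

  n : ℕ
  n = suc (suc k)

  open Completions n

  gaps-descent : ∀ {y x} → y < x → gaps (y ∷ x ∷ []) y x ≡ x ∸ suc y
  gaps-descent {y} {x} y<x = ∑-ones (x ∸ suc y) (λ j j<x∸y → cong (λ b → indicator (not b)) (cong₂ (λ e f → e ∨ (f ∨ false))
    (>⇒≡ᵇ≡false (s≤s (m≤m+n y j)))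
    (<⇒≡ᵇ≡false (subst (suc y + j <_) (m+[n∸m]≡n y<x) (+-monoʳ-< (suc y) j<x∸y)))))

  valid-descent : ∀ {y x} → y < x → x ≤ n → Valid (y ∷ x ∷ []) y x
  valid-descent {y} {x} y<x x≤n = record
    { t<M = y<x
    ; M∈S = ∨-true (x ≡ᵇ y) (cong (_∨ false) (≡ᵇ-refl x))
    ; S≤M = ∷-bounded (x ∷ []) (<⇒≤ y<x) (∷-bounded [] ≤-refl λ _ ())
    ; M≤n = x≤n
    }

  descents : ℕ → ℕ → ℕ
  descents x y = if y <ᵇ x then completions (y ∷ x ∷ []) y x k else 0

  countᵇ-desarrangementAvoider-∷∷ : ∀ x y →
    countᵇ (λ w → distinct (x ∷ y ∷ w) ∧ (isDesarrangement (x ∷ y ∷ w) ∧ avoids321 (x ∷ y ∷ w))) (words n k) ≡ descents x y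
  countᵇ-desarrangementAvoider-∷∷ x y = trans (countᵇ-cong (words n k) (desarrangementAvoider≡admissible x y)) (byDescent (y <ᵇ x))
    where
    byDescent : ∀ b → countᵇ (λ w → b ∧ admissible (y ∷ x ∷ []) y x w) (words n k)
                        ≡ (if b then completions (y ∷ x ∷ []) y x k else 0)
    byDescent true  = refl
    byDescent false = countᵇ-false (words n k)

  -- A 321-avoiding desarrangement must start with a descent onto 1: a smaller
  -- value left free below the second entry could never be placed.
  descents-above1 : ∀ {x} j → x ≤ n → descents x (suc (suc j)) ≡ 0
  descents-above1 {x} j x≤n with suc (suc j) <ᵇ x in y<x
  ... | false = refl
  ... | true  = trans (completions≡extensions k _ _ _ (valid-descent y<x′ x≤n)) (extensions-tooLong k _ _ tooShort)
    where
    y<x′ : suc (suc j) < x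
    y<x′ = <ᵇ≡true⇒< _ _ y<x
    tooShort : gaps (suc (suc j) ∷ x ∷ []) (suc (suc j)) x + (n ∸ x) < k
    tooShort = begin-strict
      gaps (suc (suc j) ∷ x ∷ []) (suc (suc j)) x + (n ∸ x) ≡⟨ cong (_+ (n ∸ x)) (gaps-descent y<x′) ⟩
      (x ∸ suc (suc (suc j))) + (n ∸ x)                  ≡⟨ ∸-+-∸ y<x′ x≤n ⟩
      n ∸ suc (suc (suc j))                              <⟨ ∸-monoʳ-< {k} {suc j} {0} z<s (≤-pred (≤-pred (≤-trans y<x′ x≤n))) ⟩
      k                                                  ∎
      where open ≤-Reasoning

  descents-from1 : ∀ i → i < suc k → descents (suc (suc i)) 1 ≡ extensions i (k ∸ i) k
  descents-from1 i i<k = trans (completions≡extensions k _ _ _ (valid-descent (s≤s z<s) (s≤s i<k)))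
                               (cong (λ b → extensions b (k ∸ i) k) (gaps-descent (s≤s z<s)))

  d321≡ballot : d321 n ≡ ballot 0 (suc k)
  d321≡ballot = begin
      d321 n
    ≡⟨ countᵇ-filterᵇ (λ π → isDesarrangement π ∧ avoids321 π) distinct (words n n) ⟩
      countᵇ D (words n (suc (suc k)))
    ≡⟨ countᵇ-words-suc n (suc k) D ⟩
      ∑ n (λ i → countᵇ (λ w → D (suc i ∷ w)) (words n (suc k)))
    ≡⟨ ∑-cong n (λ i i<n → trans (countᵇ-words-suc n k (λ w → D (suc i ∷ w))) (secondEntries i i<n)) ⟩
      ∑ n (λ i → descents (suc i) 1)
    ≡⟨ cong (descents 1 1 +_) (∑-cong (suc k) descents-from1) ⟩
      ballot 0 (suc k) ∎
    where
    open ≡-Reasoning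
    D : List ℕ → Bool
    D π = distinct π ∧ (isDesarrangement π ∧ avoids321 π)
    secondEntries : ∀ i → i < n → ∑ n (λ j → countᵇ (λ w → D (suc i ∷ suc j ∷ w)) (words n k)) ≡ descents (suc i) 1
    secondEntries i i<n = begin
        ∑ n (λ j → countᵇ (λ w → D (suc i ∷ suc j ∷ w)) (words n k))
      ≡⟨ ∑-cong n (λ j _ → countᵇ-desarrangementAvoider-∷∷ (suc i) (suc j)) ⟩
        descents (suc i) 1 + ∑ (suc k) (λ j → descents (suc i) (suc (suc j)))
      ≡⟨ cong (descents (suc i) 1 +_) (∑-zero (suc k) (λ j _ → descents-above1 j i<n)) ⟩
        descents (suc i) 1 + 0
      ≡⟨ +-identityʳ _ ⟩
        descents (suc i) 1 ∎

theorem3p7 : (n : ℕ) → 2 ≤ n → d321 n ≡ catalanPrev n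
theorem3p7 (suc (suc k)) (s≤s (s≤s z≤n)) = begin
    d321 (suc (suc k))          ≡⟨ Desarrangements.d321≡ballot k ⟩
    ballot 0 (suc k)            ≡⟨ sym (catalanPrev≡ballot (suc k)) ⟩
    catalanPrev (suc (suc k))   ∎
  where open ≡-Reasoning
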